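{- Let $k\ge3$ be an odd integer, and let $A$ be a $k$-diagonal array of size $n>k$ with width $s$, written in standard form. Let $R=(1,\dots,1)$, and let $C\in\{ -1,1\}^n$ have its entries $-1$ exactly in the positions of the list $E$. Then $R$ and $C$ are a solution of $P(A)$ if and only if both of the following hold: 1) with $d=\gcd(n,s+1)$, the list $E$ covers all congruence classes modulo $d$; 2) the list $L(1,1)$ contains all the cells $(e,e)$ with $e\in E$.
   Context: Arrays are toroidal: an $n\times n$ array has rows and columns indexed modulo $n$ (representatives $1,\dots,n$). Each cell is filled or empty; $F(A)$ is the set of filled cells. For $(i,j)\in F(A)$: - the row successor $s_r((i,j))$ is $(i,j+k)$ with $k\ge1$ minimal such that $(i,j+k)\in F(A)$; - the column successor $s_c((i,j))$ is $(i+k,j)$ with $k\ge1$ minimal such that $(i+k,j)\in F(A)$. Given $R,C\in\{ -1,1\}^n$, the move function is $S_{R,C}((i,j))=s_c^{\,c_{j'}}((i,j'))$, where $(i,j')=s_r^{\,r_i}((i,j))$; exponent $-1$ means inverse. For filled $(i,j)$, $L(i,j)=((i,j),S_{R,C}((i,j)),\dots,S_{R,C}^p((i,j)))$, where $p\ge0$ is minimal with $S_{R,C}^{p+1}((i,j))=(i,j)$. $R,C$ is a solution of $P(A)$ if $L(1,1)$ covers $F(A)$. Diagonals: $D_i=\{(i+t-1,t):t=1,\dots,n\}$, with row indices modulo $n$. A square array of size $n\ge k$ is $k$-diagonal if its filled cells are exactly those of $k$ distinct diagonals. Empty strips and width: an empty strip of width $t$ is a set $\{D_{r+1},\dots,D_{r+t}\}$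 of empty diagonals with $D_r$ and $D_{r+t+1}$ filled (indices modulo $n$). The array has width $s$ if all its empty strips have width $s$. Standard form: the array is in standard form if $D_1$ is filled and $D_n$ is empty. "$E$ covers all congruence classes modulo $d$" means every residue modulo $d$ is congruent to some element of $E$. -}

module Defs where

open import Data.Nat using (ℕ; zero; suc; _+_; _*_; _∸_; _≤_; _<_)
open import Data.Nat.DivMod using (_%_; m%n<n)
open import Data.Fin using (Fin; toℕ; fromℕ<) renaming (zero to fzero)
open import Data.Bool using (Bool; true; false; if_then_else_)
open import Data.Product using (_×_; _,_; Σ; ∃; proj₁; proj₂)
open import Data.List using (List; length)
open import Data.List.Relation.Unary.Any using (Any)
open import Data.List.Relation.Unary.Unique.Propositional using (Unique)
open import Relation.Binary.PropositionalEquality using (_≡_; _≢_)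
open import Function.Bundles using (_⇔_)

-- Conventions: indices are 0-based; Fin n element i stands for the
-- paper's representative i+1.  Arithmetic is modulo n.

shift : ∀ {n} → Fin n → ℕ → Fin n
shift {suc m} i k = fromℕ< (m%n<n (toℕ i + k) (suc m))

Cell : ℕ → Set
Cell n = Fin n × Fin n

-- An n×n toroidal array: A i j ≡ true iff cell (i,j) is filled.
Array : ℕ → Set
Array n = Fin n → Fin n → Bool

Filled : ∀ {n} → Array n → Cell n → Set
Filled A (i , j) = A i j ≡ true

-- least k in [a, a + fuel) with p k (default a + fuel if none)
find : (ℕ → Bool) → ℕ → ℕ → ℕ
find p zero a = a
find p (suc f) a = if p a then a else find p f (suc a)

-- row successor s_r: (i, j+k) with k ≥ 1 minimal such that (i,j+k) is filled
rowSucc : ∀ {n} → Array n → Cell n → Cell n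
rowSucc {n} A (i , j) = i , shift j (find (λ k → A i (shift j k)) n 1)

rowPred : ∀ {n} → Array n → Cell n → Cell n
rowPred {n} A (i , j) = i , shift j (n ∸ find (λ k → A i (shift j (n ∸ k))) n 1)

colSucc : ∀ {n} → Array n → Cell n → Cell n
colSucc {n} A (i , j) = shift i (find (λ k → A (shift i k) j) n 1) , j

colPred : ∀ {n} → Array n → Cell n → Cell n
colPred {n} A (i , j) = shift i (n ∸ find (λ k → A (shift i (n ∸ k)) j) n 1) , j

data Sign : Set where
  plus minus : Sign

rowMove : ∀ {n} → Array n → Sign → Cell n → Cell n
rowMove A plus = rowSucc A
rowMove A minus = rowPred A

colMove : ∀ {n} → Array n → Sign → Cell n → Cell n
colMove A plus = colSucc A
colMove A minus = colPred A

move : ∀ {n} → Array n → (R C : Fin n → Sign) → Cell n → Cell n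
move A R C (i , j) =
  let y = rowMove A (R i) (i , j) in colMove A (C (proj₂ y)) y

iter : ∀ {a} {X : Set a} → (X → X) → ℕ → X → X
iter f zero x = x
iter f (suc m) x = f (iter f m x)

-- x occurs in the list L(c) = (c, S c, ..., S^p c), p minimal with S^{p+1} c = c:
-- x = S^m c for some m such that S^q c ≠ c for all 1 ≤ q ≤ m (i.e. m ≤ p).
InL : ∀ {n} → Array n → (R C : Fin n → Sign) → Cell n → Cell n → Set
InL A R C c x =
  ∃ λ m → iter (move A R C) m c ≡ x
        × (∀ q → 1 ≤ q → q ≤ m → iter (move A R C) q c ≢ c)

cell11 : ∀ {n} → 0 < n → Cell n
cell11 {suc m} _ = fzero , fzero

IsSolution : ∀ {n} → 0 < n → Array n → (R C : Fin n → Sign) → Set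
IsSolution {n} pos A R C = ∀ (x : Cell n) → Filled A x → InL A R C (cell11 pos) x

-- diagonals: D_{δ+1} = {(δ + t, t)} (0-based); δ read modulo n
OnDiag : ∀ {n} → Fin n → Cell n → Set
OnDiag δ (i , j) = i ≡ shift j (toℕ δ)

DiagFilled : ∀ {n} → Array n → ℕ → Set
DiagFilled A δ = ∀ j → A (shift j δ) j ≡ true

DiagEmpty : ∀ {n} → Array n → ℕ → Set
DiagEmpty A δ = ∀ j → A (shift j δ) j ≡ false

IsKDiagonal : (k : ℕ) → ∀ {n} → Array n → Set
IsKDiagonal k {n} A =
  k ≤ n × Σ (List (Fin n)) λ Ds →
    length Ds ≡ k × Unique Ds ×
    (∀ (x : Cell n) → Filled A x ⇔ Any (λ δ → OnDiag δ x) Ds)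

EmptyStrip : ∀ {n} → Array n → ℕ → ℕ → Set
EmptyStrip A r t =
  1 ≤ t × DiagFilled A r × (∀ u → 1 ≤ u → u ≤ t → DiagEmpty A (r + u))
        × DiagFilled A (r + t + 1)

HasWidth : ∀ {n} → Array n → ℕ → Set
HasWidth A s = ∀ r t → EmptyStrip A r t → t ≡ s

StandardForm : ∀ {n} → Array n → Set
StandardForm {n} A = DiagFilled A 0 × DiagEmpty A (n ∸ 1)

ModEq : ℕ → ℕ → ℕ → Set
ModEq d a b = ∃ λ x → ∃ λ y → a + x * d ≡ b + y * d

-- E covers all congruence classes modulo d (positions are 1-based: toℕ e + 1)
CoversClasses : ∀ {n} → ℕ → List (Fin n) → Set
CoversClasses d E = ∀ (r : ℕ) → Any (λ e → ModEq d (toℕ e + 1) r) E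

-- Lemma 4.18.  A k-diagonal array (k ≥ 3 odd) is constant along diagonals, so a
-- cell is given by its diagonal δ and its column.  With R = (1,…,1) the move goes
-- right from δ to the previous filled diagonal prev δ, then up back to δ when C is
-- 1 in the new column and down to prev (prev δ) when C is -1; the column advances
-- by the gap δ - prev δ, which is 1 or s + 1 (width s), and s + 1 below diagonal 0
-- (standard form).  Sufficiency: prev cycles through the k filled diagonals, and
-- as k is odd so does prev²; from the cells (e, e) one descends by prev² through
-- the columns of E on every filled diagonal, and walks along each diagonal from a
-- column of E to any column, which Bézout provides from the coverage condition.
-- Necessity: if E misses a class modulo gcd(n, s + 1), the cells of diagonal 0 in
-- that class are closed under the move and its inverse, so L(1,1) stays inside or
-- outside them and misses a filled cell.
module Submission where

open import Defs
open import Data.Nat using (ℕ; _+_; _%_; _≤_; _<_; suc)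
open import Data.Nat.GCD using (gcd)
open import Data.Fin using (Fin)
open import Data.List using (List)
open import Data.List.Membership.Propositional using (_∈_)
open import Data.List.Membership.Propositional using (lose) renaming (find to find-∈)
open import Data.Product using (_×_; _,_)
open import Relation.Binary.PropositionalEquality using (_≡_)
open import Function.Bundles using (_⇔_)

open import Data.Nat
open import Data.Nat.Properties
open import Data.Nat.DivMod
open import Data.Nat.Divisibility using (_∣_; divides; ∣-trans; 1∣_; n∣m*n; ∣m+n∣m⇒∣n; ∣m∣n⇒∣m+n)
open import Data.Nat.GCD using (gcd-GCD; module Bézout; gcd[m,n]∣m; gcd[m,n]∣n; gcd[m,n]≢0)
open import Data.Nat.Tactic.RingSolver using (solve-∀)
open import Data.Nat.Induction using (<-rec)
open import Data.Fin using (toℕ) renaming (zero to fzero)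
open import Data.Fin.Properties using (toℕ-fromℕ<; toℕ-injective; toℕ<n) renaming (_≟_ to _≟ᶠ_)
open import Data.List using ([]; _∷_; length)
open import Data.List.Relation.Unary.Any using (Any; here; there; any?)
import Data.List.Relation.Unary.Any as Any
open import Data.List.Relation.Unary.All using ([]; _∷_)
import Data.List.Relation.Unary.All as All
open import Data.List.Relation.Unary.All.Properties using (All¬⇒¬Any)
open import Data.List.Relation.Unary.AllPairs using ([]; _∷_)
open import Data.List.Relation.Unary.Unique.Propositional using (Unique)
open import Function.Bundles using (Equivalence; mk⇔)
open import Data.Bool.Properties using (⇔→≡)
open import Data.Bool using (Bool; true; false; if_then_else_) renaming (_≟_ to _≟ᵇ_)
open import Data.Product
open import Data.Product.Properties using (≡-dec)
open import Data.Sum using (_⊎_; inj₁; inj₂)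
open import Data.Empty using (⊥; ⊥-elim)
open import Relation.Nullary
open import Relation.Binary.Definitions using (DecidableEquality)
open import Relation.Binary.PropositionalEquality

true≢false : true ≢ false
true≢false ()

leastWitness : (Q : ℕ → Set) → (∀ x → Dec (Q x)) → ∀ t → Q t →
               Σ ℕ λ r → r ≤ t × Q r × (∀ u → u < r → ¬ Q u)
leastWitness Q Q? zero qt = 0 , z≤n , qt , λ u ()
leastWitness Q Q? (suc t) qt with Q? 0
... | yes q0 = 0 , z≤n , q0 , λ u ()
... | no ¬q0 with leastWitness (λ x → Q (suc x)) (λ x → Q? (suc x)) t qt
...   | r , r≤t , qr , below = suc r , s≤s r≤t , qr , below′
  where
  below′ : ∀ u → u < suc r → ¬ Q u
  below′ zero    _         = ¬q0
  below′ (suc u) (s≤s u<r) = below u u<r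

find-first : ∀ p f a r → a ≤ r → r < a + f → p r ≡ true →
             (∀ u → a ≤ u → u < r → p u ≡ false) → find p f a ≡ r
find-first p zero a r a≤r r<a _ _ =
  ⊥-elim (<⇒≱ (subst (r <_) (+-identityʳ a) r<a) a≤r)
find-first p (suc f) a r a≤r r<a+f pr misses with m≤n⇒m<n∨m≡n a≤r
... | inj₂ refl rewrite pr = refl
... | inj₁ a<r rewrite misses a ≤-refl a<r =
  find-first p f (suc a) r a<r (subst (r <_) (+-suc a f) r<a+f) pr
             (λ u a<u → misses u (<⇒≤ a<u))

FirstHit : (ℕ → Bool) → ℕ → ℕ → Set
FirstHit p a r = a ≤ r × p r ≡ true × (∀ u → a ≤ u → u < r → p u ≡ false)

find-hit : ∀ p f a t → t < f → p (a + t) ≡ true → find p f a ≤ a + t × FirstHit p a (find p f a)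
find-hit p f a t t<f pt
  with leastWitness (λ x → p (a + x) ≡ true) (λ x → p (a + x) ≟ᵇ true) t pt
... | r , r≤t , pr , below =
  subst (λ z → z ≤ a + t × FirstHit p a z)
        (sym (find-first p f a (a + r) (m≤m+n a r) (+-monoʳ-< a (≤-<-trans r≤t t<f)) pr misses))
        (+-monoʳ-≤ a r≤t , m≤m+n a r , pr , misses)
  where
  misses : ∀ u → a ≤ u → u < a + r → p u ≡ false
  misses u a≤u u<a+r with p u in pu
  ... | false = refl
  ... | true  = ⊥-elim (below (u ∸ a)
                  (+-cancelˡ-< a (u ∸ a) r (subst (_< a + r) (sym (m+[n∸m]≡n a≤u)) u<a+r))
                  (trans (cong p (m+[n∸m]≡n a≤u)) pu))

find-cong : ∀ p q f a → (∀ u → a ≤ u → u < a + f → p u ≡ q u) → find p f a ≡ find q f a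
find-cong p q zero a _ = refl
find-cong p q (suc f) a same
  rewrite same a ≤-refl (subst (a <_) (sym (+-suc a f)) (s≤s (m≤m+n a f)))
  = cong (if q a then a else_)
         (find-cong p q f (suc a) (λ u a<u u< → same u (<⇒≤ a<u) (subst (u <_) (sym (+-suc a f)) u<)))

∸-+-reassoc : ∀ x g u → u ≤ g → g ≤ x → x ∸ g + u ≡ x ∸ (g ∸ u)
∸-+-reassoc x g u u≤g g≤x = begin
  x ∸ g + u                   ≡⟨ sym (m+n∸n≡m (x ∸ g + u) (g ∸ u)) ⟩
  x ∸ g + u + (g ∸ u) ∸ (g ∸ u) ≡⟨ cong (_∸ (g ∸ u)) whole ⟩
  x ∸ (g ∸ u)                 ∎
  where
  open ≡-Reasoning
  whole : x ∸ g + u + (g ∸ u) ≡ x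
  whole = trans (+-assoc (x ∸ g) u (g ∸ u)) (trans (cong (x ∸ g +_) (m+[n∸m]≡n u≤g)) (m∸n+n≡m g≤x))

∸-flip-< : ∀ {u δ g} → u ≤ δ → δ ∸ g < u → δ ∸ u < g
∸-flip-< {u} {δ} {g} u≤δ δ∸g<u with g ≤? δ ∸ u
... | no  g≰ = ≰⇒> g≰
... | yes g≤ = ⊥-elim (<⇒≱ δ∸g<u (m+n≤o⇒m≤o∸n u (subst (_≤ δ) (+-comm g u) (m≤o∸n⇒m+n≤o g u≤δ g≤))))

iter-+ : ∀ {X : Set} (f : X → X) a b x → iter f (a + b) x ≡ iter f a (iter f b x)
iter-+ f zero    b x = refl
iter-+ f (suc a) b x = cong f (iter-+ f a b x)

iter-suc : ∀ {X : Set} (f : X → X) a x → iter f (suc a) x ≡ iter f a (f x)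
iter-suc f a x = trans (cong (λ z → iter f z x) (+-comm 1 a)) (iter-+ f a 1 x)

iter-square : ∀ {X : Set} (f : X → X) t x → iter (λ y → f (f y)) t x ≡ iter f (t + t) x
iter-square f zero    x = refl
iter-square f (suc t) x =
  trans (cong (λ z → f (f z)) (iter-square f t x)) (cong (λ z → iter f z x) (sym (cong suc (+-suc t t))))

iter-invariant : ∀ {X : Set} (f : X → X) (P : X → Set) → (∀ x → P x → P (f x)) →
                 ∀ t {x} → P x → P (iter f t x)
iter-invariant f P step zero    px = px
iter-invariant f P step (suc t) px = step _ (iter-invariant f P step t px)

halve : ∀ i → Σ ℕ λ t → t + t ≡ i ⊎ suc (t + t) ≡ i
halve zero = 0 , inj₁ refl
halve (suc i) with halve i
... | t , inj₁ even = t , inj₂ (cong suc even)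
... | t , inj₂ odd  = suc t , inj₁ (cong suc (trans (+-suc t t) odd))

odd-half : ∀ K → K % 2 ≡ 1 → Σ ℕ λ u → suc (u + u) ≡ K
odd-half K odd with halve K
... | u , inj₂ e = u , e
... | u , inj₁ e = ⊥-elim (0≢1+n (trans (sym (m*n%n≡0 u 2)) (trans (cong (_% 2) u*2≡K) odd)))
  where
  u*2≡K : u * 2 ≡ K
  u*2≡K = trans (*-comm u 2) (trans (cong (u +_) (+-identityʳ u)) e)

-- On an orbit of odd period K, the iterates of f are iterates of f ∘ f:
-- an odd i is reached by f ∘ f after (i + K) / 2 steps.
oddPeriod-square : ∀ {X : Set} (f : X → X) K x → K % 2 ≡ 1 → iter f K x ≡ x →
                   ∀ i → Σ ℕ λ t → iter (λ y → f (f y)) t x ≡ iter f i x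
oddPeriod-square f K x odd period i with odd-half K odd | halve i
... | u , refl | t , inj₁ refl = t , iter-square f t x
... | u , refl | a , inj₂ refl = suc (a + u) , (begin
  iter (λ y → f (f y)) (suc (a + u)) x      ≡⟨ iter-square f (suc (a + u)) x ⟩
  iter f (suc (a + u) + suc (a + u)) x      ≡⟨ cong (λ z → iter f z x) (regroup a u) ⟩
  iter f (suc (a + a) + suc (u + u)) x      ≡⟨ iter-+ f (suc (a + a)) (suc (u + u)) x ⟩
  iter f (suc (a + a)) (iter f (suc (u + u)) x) ≡⟨ cong (iter f (suc (a + a))) period ⟩
  iter f (suc (a + a)) x                    ∎)
  where
  open ≡-Reasoning
  regroup : ∀ a u → suc (a + u) + suc (a + u) ≡ suc (a + a) + suc (u + u)
  regroup = solve-∀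

count : (ℕ → Bool) → ℕ → ℕ
count p zero    = 0
count p (suc x) = if p x then suc (count p x) else count p x

count-hit : ∀ p x → p x ≡ true → count p (suc x) ≡ suc (count p x)
count-hit p x px rewrite px = refl

count-step : ∀ p x → count p x ≤ count p (suc x)
count-step p x with p x
... | true  = n≤1+n (count p x)
... | false = ≤-refl

count-mono : ∀ p {a b} → a ≤ b → count p a ≤ count p b
count-mono p {b = zero} z≤n = ≤-refl
count-mono p {a} {suc b} a≤1+b with m≤n⇒m<n∨m≡n a≤1+b
... | inj₂ refl       = ≤-refl
... | inj₁ (s≤s a≤b) = ≤-trans (count-mono p a≤b) (count-step p b)

count-skip : ∀ p a b → a ≤ b → (∀ u → a ≤ u → u < b → p u ≡ false) → count p b ≡ count p a
count-skip p a zero z≤n _ = refl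
count-skip p a (suc b) a≤1+b misses with m≤n⇒m<n∨m≡n a≤1+b
... | inj₂ refl       = refl
... | inj₁ (s≤s a≤b) rewrite misses b a≤b ≤-refl =
  count-skip p a b a≤b (λ u a≤u u<b → misses u a≤u (m≤n⇒m≤1+n u<b))

count-cong : ∀ p q x → (∀ y → y < x → p y ≡ q y) → count p x ≡ count q x
count-cong p q zero    _    = refl
count-cong p q (suc x) same
  rewrite same x ≤-refl | count-cong p q x (λ y y<x → same y (m≤n⇒m≤1+n y<x)) = refl

without : (ℕ → Bool) → ℕ → ℕ → Bool
without p a y with y ≟ a
... | yes _ = false
... | no  _ = p y

count-without : ∀ p a x → p a ≡ true → a < x → count p x ≡ suc (count (without p a) x)
count-without p a (suc x) pa a<1+x with x ≟ a
... | yes refl rewrite pa = cong suc (count-cong p (without p x) x (λ y y<x → same y (<⇒≢ y<x)))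
  where
  same : ∀ y → y ≢ x → p y ≡ without p x y
  same y y≢x with y ≟ x
  ... | yes y≡x = ⊥-elim (y≢x y≡x)
  ... | no  _   = refl
... | no x≢a with p x | count-without p a x pa (≤∧≢⇒< (s≤s⁻¹ a<1+x) (λ a≡x → x≢a (sym a≡x)))
...   | true  | rec = cong suc rec
...   | false | rec = rec

count-list : ∀ N (L : List (Fin N)) → Unique L → ∀ p →
             (∀ y → y < N → (p y ≡ true) ⇔ Any (λ δ → toℕ δ ≡ y) L) → count p N ≡ length L
count-list N [] _ p hits = count-skip p 0 N z≤n (λ y _ y<N → noHit y (Equivalence.to (hits y y<N)))
  where
  noHit : ∀ y → (p y ≡ true → Any (λ δ → toℕ δ ≡ y) []) → p y ≡ false
  noHit y toAny with p y
  ... | false = refl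
  ... | true with toAny refl
  ...   | ()
count-list N (a ∷ L) (a∉L ∷ uniq) p hits =
  trans (count-without p (toℕ a) N (Equivalence.from (hits (toℕ a) (toℕ<n a)) (here refl)) (toℕ<n a))
        (cong suc (count-list N L uniq (without p (toℕ a)) hits′))
  where
  notInL : Any (λ δ → toℕ δ ≡ toℕ a) L → ⊥
  notInL = All¬⇒¬Any (All.map (λ a≢δ δ≡a → a≢δ (sym (toℕ-injective δ≡a))) a∉L)
  hits′ : ∀ y → y < N → (without p (toℕ a) y ≡ true) ⇔ Any (λ δ → toℕ δ ≡ y) L
  hits′ y y<N with y ≟ toℕ a
  ... | yes refl = mk⇔ (λ ()) (λ occ → ⊥-elim (notInL occ))
  ... | no y≢a = mk⇔ (λ py → dropHead (Equivalence.to (hits y y<N) py))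
                     (λ occ → Equivalence.from (hits y y<N) (there occ))
    where
    dropHead : Any (λ δ → toℕ δ ≡ y) (a ∷ L) → Any (λ δ → toℕ δ ≡ y) L
    dropHead (here a≡y) = ⊥-elim (y≢a (sym a≡y))
    dropHead (there occ) = occ

modEq⇒% : ∀ d .{{_ : NonZero d}} a b → ModEq d a b → a % d ≡ b % d
modEq⇒% d a b (x , y , e) =
  trans (sym ([m+kn]%n≡m%n a x d)) (trans (cong (_% d) e) ([m+kn]%n≡m%n b y d))

%⇒modEq : ∀ d .{{_ : NonZero d}} a b → a % d ≡ b % d → ModEq d a b
%⇒modEq d a b e = b / d , a / d , (begin
  a + b / d * d                   ≡⟨ cong (_+ b / d * d) (m≡m%n+[m/n]*n a d) ⟩
  a % d + a / d * d + b / d * d   ≡⟨ cong (λ r → r + a / d * d + b / d * d) e ⟩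
  b % d + a / d * d + b / d * d   ≡⟨ exchange (b % d) (a / d * d) (b / d * d) ⟩
  b % d + b / d * d + a / d * d   ≡⟨ cong (_+ a / d * d) (sym (m≡m%n+[m/n]*n b d)) ⟩
  b + a / d * d                   ∎)
  where
  open ≡-Reasoning
  exchange : ∀ x y z → x + y + z ≡ x + z + y
  exchange = solve-∀

modEq? : ∀ d .{{_ : NonZero d}} a b → Dec (ModEq d a b)
modEq? d a b with a % d ≟ b % d
... | yes e = yes (%⇒modEq d a b e)
... | no ¬e = no (λ eq → ¬e (modEq⇒% d a b eq))

modEq⇒∣ : ∀ d N a b → d ∣ N → a ≤ N → ModEq d (a + 1) (b + 1) → d ∣ (b + N ∸ a)
modEq⇒∣ d N a b d∣N a≤N (x , y , eq) =
  ∣m+n∣m⇒∣n (subst (d ∣_) N+xd≡yd+D (∣m∣n⇒∣m+n d∣N (n∣m*n x))) (n∣m*n y)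
  where
  D = b + N ∸ a
  a+xd≡b+yd : a + x * d ≡ b + y * d
  a+xd≡b+yd = +-cancelʳ-≡ 1 _ _ (trans (shift1 a x d) (trans eq (sym (shift1 b y d))))
    where
    shift1 : ∀ a x d → a + x * d + 1 ≡ (a + 1) + x * d
    shift1 = solve-∀
  N+xd≡yd+D : N + x * d ≡ y * d + D
  N+xd≡yd+D = +-cancelʳ-≡ a _ _ (begin
    N + x * d + a     ≡⟨ regroup₁ N x d a ⟩
    N + (a + x * d)   ≡⟨ cong (N +_) a+xd≡b+yd ⟩
    N + (b + y * d)   ≡⟨ regroup₂ N b y d ⟩
    y * d + (b + N)   ≡⟨ cong (y * d +_) (sym (m∸n+n≡m (≤-trans a≤N (m≤n+m N b)))) ⟩
    y * d + (D + a)   ≡⟨ sym (+-assoc (y * d) D a) ⟩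
    y * d + D + a     ∎)
    where
    open ≡-Reasoning
    regroup₁ : ∀ N x d a → N + x * d + a ≡ N + (a + x * d)
    regroup₁ = solve-∀
    regroup₂ : ∀ N b y d → N + (b + y * d) ≡ y * d + (b + N)
    regroup₂ = solve-∀

gcd-combination : ∀ n G D → gcd (suc n) G ∣ D →
                  Σ ℕ λ x → Σ ℕ λ w → Σ ℕ λ z → x * G + w * suc n ≡ D + z * suc n
gcd-combination n G D (divides q D≡qg) with Bézout.identity (gcd-GCD (suc n) G)
... | Bézout.-+ u v eq = q * v , 0 , q * u , (begin
  q * v * G + 0 * suc n     ≡⟨ regroup₁ q v G n ⟩
  q * (v * G)               ≡⟨ cong (q *_) (sym eq) ⟩
  q * (g + u * suc n)       ≡⟨ regroup₂ q g u n ⟩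
  q * g + q * u * suc n     ≡⟨ cong (_+ q * u * suc n) (sym D≡qg) ⟩
  D + q * u * suc n         ∎)
  where
  open ≡-Reasoning
  g = gcd (suc n) G
  regroup₁ : ∀ q v G n → q * v * G + 0 * suc n ≡ q * (v * G)
  regroup₁ = solve-∀
  regroup₂ : ∀ q g u n → q * (g + u * suc n) ≡ q * g + q * u * suc n
  regroup₂ = solve-∀
... | Bézout.+- u v eq = q * v * n , q * u , q * v * G , (begin
  q * v * n * G + q * u * suc n       ≡⟨ cong (q * v * n * G +_) (*-assoc q u (suc n)) ⟩
  q * v * n * G + q * (u * suc n)     ≡⟨ cong (λ t → q * v * n * G + q * t) (sym eq) ⟩
  q * v * n * G + q * (g + v * G)     ≡⟨ regroup q v n G g ⟩
  q * g + q * v * G * suc n           ≡⟨ cong (_+ q * v * G * suc n) (sym D≡qg) ⟩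
  D + q * v * G * suc n               ∎)
  where
  open ≡-Reasoning
  g = gcd (suc n) G
  regroup : ∀ q v n G g → q * v * n * G + q * (g + v * G) ≡ q * g + q * v * G * suc n
  regroup = solve-∀

backward-steps : ∀ n j e G → e < suc n → G ≤ suc n → gcd (suc n) G ∣ (j + suc n ∸ e) →
                 Σ ℕ λ x → (j + x * (suc n ∸ G)) % suc n ≡ e
backward-steps n j e G e<N G≤N g∣D with gcd-combination n G (j + suc n ∸ e) g∣D
... | x , w , z , comb = x , (begin
  X % N                    ≡⟨ sym ([m+kn]%n≡m%n X (suc z) N) ⟩
  (X + suc z * N) % N      ≡⟨ cong (_% N) (+-cancelˡ-≡ j _ _ (trans (sym viaD) viaComb)) ⟩
  (e + (x + w) * N) % N    ≡⟨ [m+kn]%n≡m%n e (x + w) N ⟩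
  e % N                    ≡⟨ m<n⇒m%n≡m e<N ⟩
  e                        ∎)
  where
  open ≡-Reasoning
  N = suc n
  W = N ∸ G
  D = j + N ∸ e
  X = j + x * W
  D+e : D + e ≡ j + N
  D+e = m∸n+n≡m (≤-trans (<⇒≤ e<N) (m≤n+m N j))
  X+xG : X + x * G ≡ j + x * N
  X+xG = trans (regroup j x W G) (cong (λ t → j + x * t) (m∸n+n≡m G≤N))
    where
    regroup : ∀ j x W G → j + x * W + x * G ≡ j + x * (W + G)
    regroup = solve-∀
  -- X + (D + zN) + e computed through the combination and through D + e = j + N
  viaComb : X + (D + z * N) + e ≡ j + (e + (x + w) * N)
  viaComb = begin
    X + (D + z * N) + e        ≡⟨ cong (λ t → X + t + e) (sym comb) ⟩
    X + (x * G + w * N) + e    ≡⟨ regroup₁ X x G w N e ⟩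
    (X + x * G) + w * N + e    ≡⟨ cong (λ t → t + w * N + e) X+xG ⟩
    (j + x * N) + w * N + e    ≡⟨ regroup₂ j x N w e ⟩
    j + (e + (x + w) * N)      ∎
    where
    regroup₁ : ∀ X x G w N e → X + (x * G + w * N) + e ≡ (X + x * G) + w * N + e
    regroup₁ = solve-∀
    regroup₂ : ∀ j x N w e → (j + x * N) + w * N + e ≡ j + (e + (x + w) * N)
    regroup₂ = solve-∀
  viaD : X + (D + z * N) + e ≡ j + (X + suc z * N)
  viaD = begin
    X + (D + z * N) + e        ≡⟨ regroup₁ X D z N e ⟩
    X + z * N + (D + e)        ≡⟨ cong (X + z * N +_) D+e ⟩
    X + z * N + (j + N)        ≡⟨ regroup₂ X z N j ⟩
    j + (X + suc z * N)        ∎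
    where
    regroup₁ : ∀ X D z N e → X + (D + z * N) + e ≡ X + z * N + (D + e)
    regroup₁ = solve-∀
    regroup₂ : ∀ X z N j → X + z * N + (j + N) ≡ j + (X + suc z * N)
    regroup₂ = solve-∀

module Torus (m : ℕ) where

  N : ℕ
  N = suc m

  toℕ-shift : ∀ (j : Fin N) a → toℕ (shift j a) ≡ (toℕ j + a) % N
  toℕ-shift j a = toℕ-fromℕ< _

  shift-≡ : ∀ (j : Fin N) a j′ b → (toℕ j + a) % N ≡ (toℕ j′ + b) % N → shift j a ≡ shift j′ b
  shift-≡ j a j′ b e = toℕ-injective (trans (toℕ-shift j a) (trans e (sym (toℕ-shift j′ b))))

  toℕ%N : ∀ (j : Fin N) → toℕ j % N ≡ toℕ j
  toℕ%N j = m<n⇒m%n≡m (toℕ<n j)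

  %-absorbˡ : ∀ x b → (x % N + b) % N ≡ (x + b) % N
  %-absorbˡ x b = begin
    (x % N + b) % N          ≡⟨ %-distribˡ-+ (x % N) b N ⟩
    (x % N % N + b % N) % N  ≡⟨ cong (λ z → (z + b % N) % N) (m%n%n≡m%n x N) ⟩
    (x % N + b % N) % N      ≡⟨ sym (%-distribˡ-+ x b N) ⟩
    (x + b) % N              ∎
    where open ≡-Reasoning

  +ʳ-mod : ∀ a b c → a % N ≡ b % N → (a + c) % N ≡ (b + c) % N
  +ʳ-mod a b c e = trans (sym (%-absorbˡ a c)) (trans (cong (λ z → (z + c) % N) e) (%-absorbˡ b c))

  +ˡ-mod : ∀ a b c → a % N ≡ b % N → (c + a) % N ≡ (c + b) % N
  +ˡ-mod a b c e = trans (cong (_% N) (+-comm c a)) (trans (+ʳ-mod a b c e) (cong (_% N) (+-comm b c)))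

  +ˡ-cancel-mod : ∀ j a b → j ≤ N → (j + a) % N ≡ (j + b) % N → a % N ≡ b % N
  +ˡ-cancel-mod j a b j≤N e = begin
    a % N                    ≡⟨ sym ([m+n]%n≡m%n a N) ⟩
    (a + N) % N              ≡⟨ cong (_% N) (undo a) ⟩
    (N ∸ j + (j + a)) % N    ≡⟨ +ˡ-mod (j + a) (j + b) (N ∸ j) e ⟩
    (N ∸ j + (j + b)) % N    ≡⟨ cong (_% N) (sym (undo b)) ⟩
    (b + N) % N              ≡⟨ [m+n]%n≡m%n b N ⟩
    b % N                    ∎
    where
    open ≡-Reasoning
    undo : ∀ x → x + N ≡ N ∸ j + (j + x)
    undo x = trans (+-comm x N) (trans (cong (_+ x) (sym (m∸n+n≡m j≤N))) (+-assoc (N ∸ j) j x))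

  shift-shift : ∀ (j : Fin N) a b → shift (shift j a) b ≡ shift j (a + b)
  shift-shift j a b = shift-≡ (shift j a) b j (a + b)
    (trans (cong (λ z → (z + b) % N) (toℕ-shift j a))
           (trans (%-absorbˡ (toℕ j + a) b) (cong (_% N) (+-assoc (toℕ j) a b))))

  shift-mod : ∀ (j : Fin N) a b → a % N ≡ b % N → shift j a ≡ shift j b
  shift-mod j a b e = shift-≡ j a j b (+ˡ-mod a b (toℕ j) e)

  shift-0 : ∀ (j : Fin N) → shift j 0 ≡ j
  shift-0 j = toℕ-injective (trans (toℕ-shift j 0) (trans (cong (_% N) (+-identityʳ (toℕ j))) (toℕ%N j)))

  shift-+N : ∀ (j : Fin N) a → shift j (a + N) ≡ shift j a
  shift-+N j a = shift-mod j (a + N) a ([m+n]%n≡m%n a N)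

  shift-+kN : ∀ (j : Fin N) a k → shift j (a + k * N) ≡ shift j a
  shift-+kN j a k = shift-mod j (a + k * N) a ([m+kn]%n≡m%n a k N)

  shift-injective : ∀ (j : Fin N) a b → shift j a ≡ shift j b → a % N ≡ b % N
  shift-injective j a b e = +ˡ-cancel-mod (toℕ j) a b (<⇒≤ (toℕ<n j))
    (trans (sym (toℕ-shift j a)) (trans (cong toℕ e) (toℕ-shift j b)))

  shift-back : ∀ (c : Fin N) x y g → g ≤ N → y ≤ x →
               shift c (x * (N ∸ g) + y * g) ≡ shift c ((x ∸ y) * (N ∸ g))
  shift-back c x y g g≤N y≤x = begin
    shift c (x * W + y * g)             ≡⟨ cong (λ z → shift c (z * W + y * g)) (sym (m∸n+n≡m y≤x)) ⟩
    shift c ((x ∸ y + y) * W + y * g)   ≡⟨ cong (shift c) (regroup (x ∸ y) y W g) ⟩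
    shift c ((x ∸ y) * W + y * (W + g)) ≡⟨ cong (λ z → shift c ((x ∸ y) * W + y * z)) (m∸n+n≡m g≤N) ⟩
    shift c ((x ∸ y) * W + y * N)       ≡⟨ shift-+kN c ((x ∸ y) * W) y ⟩
    shift c ((x ∸ y) * W)               ∎
    where
    open ≡-Reasoning
    W = N ∸ g
    regroup : ∀ z y w g → (z + y) * w + y * g ≡ z * w + y * (w + g)
    regroup = solve-∀

  %N-mod-divisor : ∀ d .{{_ : NonZero d}} → d ∣ N → ∀ x y → (x % N + y) % d ≡ (x + y) % d
  %N-mod-divisor d d∣N x y = begin
    (x % N + y) % d                 ≡⟨ sym (%-remove-+ʳ (x % N + y) (∣-trans d∣N (n∣m*n (x / N)))) ⟩
    (x % N + y + x / N * N) % d     ≡⟨ cong (_% d) (exchange (x % N) y (x / N * N)) ⟩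
    (x % N + x / N * N + y) % d     ≡⟨ cong (λ z → (z + y) % d) (sym (m≡m%n+[m/n]*n x N)) ⟩
    (x + y) % d                     ∎
    where
    open ≡-Reasoning
    exchange : ∀ a b c → a + b + c ≡ a + c + b
    exchange = solve-∀

  shift-N-steps : ∀ (c : Fin N) w → shift (shift c w) (m * w) ≡ c
  shift-N-steps c w = begin
    shift (shift c w) (m * w)   ≡⟨ shift-shift c w (m * w) ⟩
    shift c (N * w)             ≡⟨ cong (shift c) (*-comm N w) ⟩
    shift c (0 + w * N)         ≡⟨ shift-+kN c 0 w ⟩
    shift c 0                   ≡⟨ shift-0 c ⟩
    c                           ∎
    where open ≡-Reasoning

  shift-around : ∀ (c : Fin N) g → g ≤ N → shift (shift c (N ∸ g)) g ≡ c
  shift-around c g g≤N = begin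
    shift (shift c (N ∸ g)) g   ≡⟨ shift-shift c (N ∸ g) g ⟩
    shift c (N ∸ g + g)         ≡⟨ cong (shift c) (m∸n+n≡m g≤N) ⟩
    shift c (0 + N)             ≡⟨ shift-+N c 0 ⟩
    shift c 0                   ≡⟨ shift-0 c ⟩
    c                           ∎
    where open ≡-Reasoning

  gcd-nonZero : ∀ t → NonZero (gcd N t)
  gcd-nonZero t = ≢-nonZero (gcd[m,n]≢0 N t (inj₁ (λ ())))

  gcd-divides-distance : ∀ {s} G → G ≡ 1 ⊎ G ≡ suc s → ∀ (j e : Fin N) →
                         ModEq (gcd N (s + 1)) (toℕ e + 1) (toℕ j + 1) → gcd N G ∣ (toℕ j + N ∸ toℕ e)
  gcd-divides-distance .1 (inj₁ refl) j e _ = ∣-trans (gcd[m,n]∣n N 1) (1∣ _)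
  gcd-divides-distance {s} .(suc s) (inj₂ refl) j e sameClass =
    subst (λ g → gcd N g ∣ (toℕ j + N ∸ toℕ e)) (+-comm s 1)
      (modEq⇒∣ (gcd N (s + 1)) N (toℕ e) (toℕ j) (gcd[m,n]∣m N (s + 1)) (<⇒≤ (toℕ<n e)) sameClass)

  cellOn : ℕ → Fin N → Cell N
  cellOn δ j = shift j δ , j

  diagOf : Cell N → ℕ
  diagOf (i , j) = (toℕ i + (N ∸ toℕ j)) % N

  diagOf<N : ∀ c → diagOf c < N
  diagOf<N (i , j) = m%n<n (toℕ i + (N ∸ toℕ j)) N

  cellOn-diagOf : ∀ c → cellOn (diagOf c) (proj₂ c) ≡ c
  cellOn-diagOf (i , j) = cong (_, j) (toℕ-injective (begin
    toℕ (shift j ((i′ + (N ∸ j′)) % N)) ≡⟨ toℕ-shift j ((i′ + (N ∸ j′)) % N) ⟩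
    (j′ + (i′ + (N ∸ j′)) % N) % N      ≡⟨ cong (_% N) (+-comm j′ _) ⟩
    ((i′ + (N ∸ j′)) % N + j′) % N      ≡⟨ %-absorbˡ (i′ + (N ∸ j′)) j′ ⟩
    (i′ + (N ∸ j′) + j′) % N            ≡⟨ cong (_% N) (trans (+-assoc i′ (N ∸ j′) j′) (cong (i′ +_) (m∸n+n≡m (<⇒≤ (toℕ<n j))))) ⟩
    (i′ + N) % N                        ≡⟨ [m+n]%n≡m%n i′ N ⟩
    i′ % N                              ≡⟨ toℕ%N i ⟩
    i′                                  ∎))
    where
    open ≡-Reasoning
    i′ = toℕ i
    j′ = toℕ j

  cellOn-injective : ∀ a b (j j′ : Fin N) → cellOn a j ≡ cellOn b j′ → j ≡ j′ × a % N ≡ b % N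
  cellOn-injective a b j j′ e with cong proj₂ e
  ... | refl = refl , shift-injective j a b (cong proj₁ e)

  diagOf-cellOn : ∀ δ j → diagOf (cellOn δ j) ≡ δ % N
  diagOf-cellOn δ j = trans (sym (m<n⇒m%n≡m (diagOf<N (cellOn δ j))))
    (proj₂ (cellOn-injective (diagOf (cellOn δ j)) δ j j (cellOn-diagOf (cellOn δ j))))

DiagonalConstant : ∀ {m} → Array (suc m) → Set
DiagonalConstant A = ∀ j δ → A (shift j δ) j ≡ A (shift fzero δ) fzero

module DiagonalArray (m : ℕ) (A : Array (suc m)) (const : DiagonalConstant A) where
  open Torus m

  filled : ℕ → Bool
  filled δ = A (shift fzero δ) fzero

  filled-mod : ∀ a b → a % N ≡ b % N → filled a ≡ filled b
  filled-mod a b e = cong (λ z → A z fzero) (shift-mod fzero a b e)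

  filled-+N : ∀ a → filled (a + N) ≡ filled a
  filled-+N a = filled-mod (a + N) a ([m+n]%n≡m%n a N)

  filled-% : ∀ a → filled (a % N) ≡ filled a
  filled-% a = filled-mod (a % N) a (m%n%n≡m%n a N)

  -- distance from δ down to the previous filled diagonal
  gap : ℕ → ℕ
  gap δ = find (λ t → filled (δ + N ∸ t)) N 1

  record GapSpec (δ : ℕ) : Set where
    field
      gap≥1   : 1 ≤ gap δ
      gap≤N   : gap δ ≤ N
      landing : filled (δ + N ∸ gap δ) ≡ true
      skipped : ∀ t → 1 ≤ t → t < gap δ → filled (δ + N ∸ t) ≡ false

  -- the search for the previous filled diagonal succeeds at the latest at δ itself
  gapSpec : ∀ δ → filled δ ≡ true → GapSpec δ
  gapSpec δ fδ with find-hit (λ t → filled (δ + N ∸ t)) N 1 m ≤-refl (trans (cong filled (m+n∸n≡m δ N)) fδ)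
  ... | gap≤N , gap≥1 , landing , skipped = record
    { gap≥1 = gap≥1 ; gap≤N = gap≤N ; landing = landing ; skipped = λ t → skipped t }

  prev : ℕ → ℕ
  prev δ = (δ + N ∸ gap δ) % N

  prev-filled : ∀ δ → filled δ ≡ true → filled (prev δ) ≡ true
  prev-filled δ fδ = trans (filled-% (δ + N ∸ gap δ)) (GapSpec.landing (gapSpec δ fδ))

  prev² : ℕ → ℕ
  prev² δ = prev (prev δ)

  prev²-filled : ∀ δ → filled δ ≡ true → filled (prev² δ) ≡ true
  prev²-filled δ fδ = prev-filled (prev δ) (prev-filled δ fδ)

  row-view : ∀ δ j u → u ≤ N → A (shift j δ) (shift j u) ≡ filled (δ + N ∸ u)
  row-view δ j u u≤N = trans (cong (λ z → A z (shift j u)) (sym same-row)) (const (shift j u) (δ + N ∸ u))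
    where
    same-row : shift (shift j u) (δ + N ∸ u) ≡ shift j δ
    same-row = trans (shift-shift j u (δ + N ∸ u))
      (trans (cong (shift j) (m+[n∸m]≡n (≤-trans u≤N (m≤n+m N δ)))) (shift-+N j δ))

  column-view : ∀ a j k → A (shift (shift j a) k) j ≡ filled (a + k)
  column-view a j k = trans (cong (λ z → A z j) (shift-shift j a k)) (const j (a + k))

  prev-same-row : ∀ δ j → filled δ ≡ true → shift (shift j (gap δ)) (prev δ) ≡ shift j δ
  prev-same-row δ j fδ = begin
    shift (shift j (gap δ)) (prev δ)            ≡⟨ shift-mod (shift j (gap δ)) (prev δ) (δ + N ∸ gap δ) (m%n%n≡m%n (δ + N ∸ gap δ) N) ⟩
    shift (shift j (gap δ)) (δ + N ∸ gap δ)     ≡⟨ shift-shift j (gap δ) (δ + N ∸ gap δ) ⟩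
    shift j (gap δ + (δ + N ∸ gap δ))           ≡⟨ cong (shift j) (m+[n∸m]≡n (≤-trans (GapSpec.gap≤N (gapSpec δ fδ)) (m≤n+m N δ))) ⟩
    shift j (δ + N)                             ≡⟨ shift-+N j δ ⟩
    shift j δ                                   ∎
    where open ≡-Reasoning

  rowSucc-cellOn : ∀ δ j → filled δ ≡ true → rowSucc A (cellOn δ j) ≡ cellOn (prev δ) (shift j (gap δ))
  rowSucc-cellOn δ j fδ = begin
    rowSucc A (cellOn δ j)              ≡⟨ cong (λ z → shift j δ , shift j z) (find-cong _ _ N 1 (λ u _ u<1+N → row-view δ j u (s≤s⁻¹ u<1+N))) ⟩
    (shift j δ , shift j (gap δ))       ≡⟨ cong (_, shift j (gap δ)) (sym (prev-same-row δ j fδ)) ⟩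
    cellOn (prev δ) (shift j (gap δ))   ∎
    where open ≡-Reasoning

  colSucc-prev : ∀ δ j → filled δ ≡ true → colSucc A (cellOn (prev δ) j) ≡ cellOn δ j
  colSucc-prev δ j fδ = cong (_, j) (begin
    shift (shift j (prev δ)) (find (λ k → A (shift (shift j (prev δ)) k) j) N 1)
      ≡⟨ cong (shift (shift j (prev δ))) (find-first _ N 1 (gap δ) gap≥1 (s≤s gap≤N) hit miss) ⟩
    shift (shift j (prev δ)) (gap δ)   ≡⟨ shift-shift j (prev δ) (gap δ) ⟩
    shift j (prev δ + gap δ)           ≡⟨ shift-mod j (prev δ + gap δ) δ back ⟩
    shift j δ                          ∎)
    where
    open ≡-Reasoning
    open GapSpec (gapSpec δ fδ)
    δ′ = δ + N ∸ gap δ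
    above : ∀ k → A (shift (shift j (prev δ)) k) j ≡ filled (δ′ + k)
    above k = trans (column-view (prev δ) j k)
      (filled-mod (prev δ + k) (δ′ + k) (+ʳ-mod (prev δ) δ′ k (m%n%n≡m%n δ′ N)))
    δ′+gap : δ′ + gap δ ≡ δ + N
    δ′+gap = m∸n+n≡m (≤-trans gap≤N (m≤n+m N δ))
    back : (prev δ + gap δ) % N ≡ δ % N
    back = trans (+ʳ-mod (prev δ) δ′ (gap δ) (m%n%n≡m%n δ′ N))
                 (trans (cong (_% N) δ′+gap) ([m+n]%n≡m%n δ N))
    hit : A (shift (shift j (prev δ)) (gap δ)) j ≡ true
    hit = trans (above (gap δ)) (trans (cong filled δ′+gap) (trans (filled-+N δ) fδ))
    miss : ∀ u → 1 ≤ u → u < gap δ → A (shift (shift j (prev δ)) u) j ≡ false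
    miss u 1≤u u<gap = trans (above u)
      (trans (cong filled (∸-+-reassoc (δ + N) (gap δ) u (<⇒≤ u<gap) (≤-trans gap≤N (m≤n+m N δ))))
             (skipped (gap δ ∸ u) (m<n⇒0<n∸m u<gap) (∸-monoʳ-< {gap δ} {u} {0} 1≤u (<⇒≤ u<gap))))

  colPred-cellOn : ∀ δ j → filled δ ≡ true → colPred A (cellOn δ j) ≡ cellOn (prev δ) j
  colPred-cellOn δ j fδ = cong (_, j) (begin
    shift (shift j δ) (N ∸ find (λ k → A (shift (shift j δ) (N ∸ k)) j) N 1)
      ≡⟨ cong (λ z → shift (shift j δ) (N ∸ z)) (find-cong _ _ N 1 below) ⟩
    shift (shift j δ) (N ∸ gap δ)   ≡⟨ shift-shift j δ (N ∸ gap δ) ⟩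
    shift j (δ + (N ∸ gap δ))       ≡⟨ shift-mod j _ _ (trans (cong (_% N) (sym (+-∸-assoc δ gap≤N))) (sym (m%n%n≡m%n (δ + N ∸ gap δ) N))) ⟩
    shift j (prev δ)                ∎)
    where
    open ≡-Reasoning
    open GapSpec (gapSpec δ fδ)
    below : ∀ u → 1 ≤ u → u < 1 + N → A (shift (shift j δ) (N ∸ u)) j ≡ filled (δ + N ∸ u)
    below u _ u<1+N = trans (column-view δ j (N ∸ u)) (cong filled (sym (+-∸-assoc δ (s≤s⁻¹ u<1+N))))

  filled-diagOf : ∀ c → A (proj₁ c) (proj₂ c) ≡ filled (diagOf c)
  filled-diagOf c = trans (cong (λ x → A (proj₁ x) (proj₂ x)) (sym (cellOn-diagOf c))) (const (proj₂ c) (diagOf c))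

  diagonal-cells-filled : filled 0 ≡ true → ∀ e → Filled A (e , e)
  diagonal-cells-filled D₀ e = trans (cong (λ i → A i e) (sym (shift-0 e))) (trans (const e 0) D₀)

  diagFilled : ∀ δ → filled δ ≡ true → DiagFilled A δ
  diagFilled δ fδ j = trans (const j δ) fδ

  diagEmpty : ∀ δ → filled δ ≡ false → DiagEmpty A δ
  diagEmpty δ eδ j = trans (const j δ) eδ

  -- In an array of width s, consecutive filled diagonals are adjacent or s + 1 apart:
  -- a gap larger than 1 encloses an empty strip of width gap - 1.
  gap-width : ∀ {s} → HasWidth A s → ∀ δ → filled δ ≡ true → gap δ ≡ 1 ⊎ gap δ ≡ suc s
  gap-width hw δ fδ with m≤n⇒m<n∨m≡n (GapSpec.gap≥1 (gapSpec δ fδ))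
  ... | inj₂ 1≡gap = inj₁ (sym 1≡gap)
  ... | inj₁ 1<gap = inj₂ (trans (sym (m+[n∸m]≡n gap≥1)) (cong suc (hw r t strip)))
    where
    open GapSpec (gapSpec δ fδ)
    t = gap δ ∸ 1
    r = δ + N ∸ gap δ
    gap≤δ+N : gap δ ≤ δ + N
    gap≤δ+N = ≤-trans gap≤N (m≤n+m N δ)
    inside : ∀ u → 1 ≤ u → u ≤ t → DiagEmpty A (r + u)
    inside u 1≤u u≤t = diagEmpty (r + u)
      (trans (cong filled (∸-+-reassoc (δ + N) (gap δ) u (<⇒≤ u<gap) gap≤δ+N))
             (skipped (gap δ ∸ u) (m<n⇒0<n∸m u<gap) (∸-monoʳ-< {gap δ} {u} {0} 1≤u (<⇒≤ u<gap))))
      where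
      u<gap : u < gap δ
      u<gap = ≤-<-trans u≤t (∸-monoʳ-< {gap δ} {1} {0} (s≤s z≤n) gap≥1)
    r+t+1 : r + t + 1 ≡ δ + N
    r+t+1 = trans (+-assoc r t 1) (trans (cong (r +_) (m∸n+n≡m gap≥1)) (m∸n+n≡m gap≤δ+N))
    strip : EmptyStrip A r t
    strip = m<n⇒0<n∸m 1<gap , diagFilled r landing , inside ,
            diagFilled (r + t + 1) (trans (cong filled r+t+1) (trans (filled-+N δ) fδ))

  -- In standard form, D_1 is filled and D_n empty, so the gap below diagonal 0 is s + 1.
  gap-0 : ∀ {s} → HasWidth A s → StandardForm A → gap 0 ≡ suc s
  gap-0 hw (D₁filled , Dₙempty) with gap-width hw 0 (D₁filled fzero)
  ... | inj₂ gap≡1+s = gap≡1+s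
  ... | inj₁ gap≡1 = ⊥-elim (true≢false (begin
    true               ≡⟨ sym (subst (λ g → filled (N ∸ g) ≡ true) gap≡1 (GapSpec.landing (gapSpec 0 (D₁filled fzero)))) ⟩
    filled (N ∸ 1)     ≡⟨ Dₙempty fzero ⟩
    false              ∎))
    where open ≡-Reasoning

  rank : ℕ → ℕ
  rank = count filled

  -- When diagonal 0 is filled, `prev` runs through the filled diagonals in
  -- decreasing order and wraps around from 0 to the top filled diagonal.  The
  -- number of steps from δ down to δ₀ is the number of filled diagonals in [δ₀, δ).
  module Cycle (D₀ : filled 0 ≡ true) where

    gap≤ : ∀ δ → 0 < δ → filled δ ≡ true → gap δ ≤ δ
    gap≤ δ 0<δ fδ with gap δ ≤? δ
    ... | yes gap≤δ = gap≤δ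
    ... | no  gap≰δ = ⊥-elim (true≢false (begin
      true                ≡⟨ sym D₀ ⟩
      filled 0            ≡⟨ sym (filled-+N 0) ⟩
      filled (0 + N)      ≡⟨ cong filled (sym (m+n∸m≡n δ N)) ⟩
      filled (δ + N ∸ δ)  ≡⟨ GapSpec.skipped (gapSpec δ fδ) δ 0<δ (≰⇒> gap≰δ) ⟩
      false               ∎))
      where open ≡-Reasoning

    prev-below : ∀ δ → δ < N → gap δ ≤ δ → prev δ ≡ δ ∸ gap δ
    prev-below δ δ<N gap≤δ = trans (cong (_% N) (+-∸-comm N gap≤δ))
      (trans ([m+n]%n≡m%n (δ ∸ gap δ) N) (m<n⇒m%n≡m (≤-<-trans (m∸n≤m δ (gap δ)) δ<N)))

    filled-below : ∀ δ → 0 < δ → filled δ ≡ true → filled (δ ∸ gap δ) ≡ true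
    filled-below δ 0<δ fδ = trans (sym (filled-+N (δ ∸ gap δ)))
      (trans (cong filled (sym (+-∸-comm N (gap≤ δ 0<δ fδ)))) (GapSpec.landing (gapSpec δ fδ)))

    unfilled-between : ∀ δ u → filled δ ≡ true → u < δ → δ ∸ gap δ < u → filled u ≡ false
    unfilled-between δ u fδ u<δ below-u = trans (sym (filled-+N u))
      (trans (cong filled (sym distance))
             (GapSpec.skipped (gapSpec δ fδ) (δ ∸ u) (m<n⇒0<n∸m u<δ) (∸-flip-< (<⇒≤ u<δ) below-u)))
      where
      distance : δ + N ∸ (δ ∸ u) ≡ u + N
      distance = trans (+-∸-comm N (m∸n≤m δ u)) (cong (_+ N) (m∸[m∸n]≡n (<⇒≤ u<δ)))

    rank-prev : ∀ δ → 0 < δ → filled δ ≡ true → rank δ ≡ suc (rank (δ ∸ gap δ))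
    rank-prev δ 0<δ fδ =
      trans (count-skip filled (suc (δ ∸ gap δ)) δ below<δ (λ u above≤u u<δ → unfilled-between δ u fδ u<δ above≤u))
            (count-hit filled (δ ∸ gap δ) (filled-below δ 0<δ fδ))
      where
      below<δ : δ ∸ gap δ < δ
      below<δ = ∸-monoʳ-< {δ} {gap δ} {0} (GapSpec.gap≥1 (gapSpec δ fδ)) (gap≤ δ 0<δ fδ)

    Walk : ℕ → Set
    Walk δ = ∀ δ₀ → δ < N → filled δ ≡ true → filled δ₀ ≡ true → δ₀ ≤ δ →
             iter prev (rank δ ∸ rank δ₀) δ ≡ δ₀

    walk : ∀ δ → Walk δ
    walk = <-rec Walk walk-step
      where
      walk-step : ∀ δ → (∀ {δ′} → δ′ < δ → Walk δ′) → Walk δ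
      walk-step δ rec δ₀ δ<N fδ fδ₀ δ₀≤δ with m≤n⇒m<n∨m≡n δ₀≤δ
      ... | inj₂ refl = cong (λ z → iter prev z δ) (n∸n≡0 (rank δ))
      ... | inj₁ δ₀<δ = begin
        iter prev (rank δ ∸ rank δ₀) δ          ≡⟨ cong (λ z → iter prev (z ∸ rank δ₀) δ) (rank-prev δ 0<δ fδ) ⟩
        iter prev (suc (rank δ′) ∸ rank δ₀) δ   ≡⟨ cong (λ z → iter prev z δ) (+-∸-assoc 1 (count-mono filled δ₀≤δ′)) ⟩
        iter prev (suc (rank δ′ ∸ rank δ₀)) δ   ≡⟨ iter-suc prev (rank δ′ ∸ rank δ₀) δ ⟩
        iter prev (rank δ′ ∸ rank δ₀) (prev δ)  ≡⟨ cong (iter prev (rank δ′ ∸ rank δ₀)) (prev-below δ δ<N gap≤δ) ⟩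
        iter prev (rank δ′ ∸ rank δ₀) δ′        ≡⟨ rec δ′<δ δ₀ (≤-<-trans (<⇒≤ δ′<δ) δ<N) (filled-below δ 0<δ fδ) fδ₀ δ₀≤δ′ ⟩
        δ₀                                     ∎
        where
        open ≡-Reasoning
        0<δ : 0 < δ
        0<δ = ≤-<-trans z≤n δ₀<δ
        gap≤δ = gap≤ δ 0<δ fδ
        δ′ = δ ∸ gap δ
        δ′<δ : δ′ < δ
        δ′<δ = ∸-monoʳ-< {δ} {gap δ} {0} (GapSpec.gap≥1 (gapSpec δ fδ)) gap≤δ
        δ₀≤δ′ : δ₀ ≤ δ′
        δ₀≤δ′ with δ₀ ≤? δ′
        ... | yes δ₀≤ = δ₀≤
        ... | no  δ₀≰ = ⊥-elim (true≢false (trans (sym fδ₀) (unfilled-between δ δ₀ fδ δ₀<δ (≰⇒> δ₀≰))))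

    -- the top filled diagonal, reached from 0 in one step
    top : ℕ
    top = N ∸ gap 0

    top<N : top < N
    top<N = ∸-monoʳ-< {N} {gap 0} {0} (GapSpec.gap≥1 (gapSpec 0 D₀)) (GapSpec.gap≤N (gapSpec 0 D₀))

    prev-0 : prev 0 ≡ top
    prev-0 = m<n⇒m%n≡m top<N

    filled-top : filled top ≡ true
    filled-top = GapSpec.landing (gapSpec 0 D₀)

    unfilled-above : ∀ u → u < N → top < u → filled u ≡ false
    unfilled-above u u<N top<u =
      trans (cong filled (sym (m∸[m∸n]≡n (<⇒≤ u<N))))
            (GapSpec.skipped (gapSpec 0 D₀) (N ∸ u) (m<n⇒0<n∸m u<N) (∸-flip-< (<⇒≤ u<N) top<u))

    filled-≤top : ∀ δ → δ < N → filled δ ≡ true → δ ≤ top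
    filled-≤top δ δ<N fδ with δ ≤? top
    ... | yes δ≤top = δ≤top
    ... | no  δ≰top = ⊥-elim (true≢false (trans (sym fδ) (unfilled-above δ δ<N (≰⇒> δ≰top))))

    rank-N : rank N ≡ suc (rank top)
    rank-N = trans (count-skip filled (suc top) N top<N (λ u top<u u<N → unfilled-above u u<N top<u))
                   (count-hit filled top filled-top)

    reach : ∀ δ → δ < N → filled δ ≡ true → iter prev (rank N ∸ rank δ) 0 ≡ δ
    reach δ δ<N fδ = begin
      iter prev (rank N ∸ rank δ) 0           ≡⟨ cong (λ z → iter prev (z ∸ rank δ) 0) rank-N ⟩
      iter prev (suc (rank top) ∸ rank δ) 0   ≡⟨ cong (λ z → iter prev z 0) (+-∸-assoc 1 (count-mono filled (filled-≤top δ δ<N fδ))) ⟩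
      iter prev (suc (rank top ∸ rank δ)) 0   ≡⟨ iter-suc prev (rank top ∸ rank δ) 0 ⟩
      iter prev (rank top ∸ rank δ) (prev 0)  ≡⟨ cong (iter prev (rank top ∸ rank δ)) prev-0 ⟩
      iter prev (rank top ∸ rank δ) top       ≡⟨ walk top δ top<N filled-top fδ (filled-≤top δ δ<N fδ) ⟩
      δ                                       ∎
      where open ≡-Reasoning

    reach-twice : rank N % 2 ≡ 1 → ∀ δ → δ < N → filled δ ≡ true →
                  Σ ℕ λ t → iter prev² t 0 ≡ δ
    reach-twice odd δ δ<N fδ with oddPeriod-square prev (rank N) 0 odd (reach 0 (s≤s z≤n) D₀) (rank N ∸ rank δ)
    ... | t , twice = t , trans twice (reach δ δ<N fδ)

firstVisit : ∀ {X : Set} → DecidableEquality X → (f : X → X) (c x : X) (t : ℕ) → iter f t c ≡ x →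
             Σ ℕ λ m → iter f m c ≡ x × (∀ q → 1 ≤ q → q ≤ m → iter f q c ≢ c)
firstVisit _≟ₓ_ f c x t reached with leastWitness (λ u → iter f u c ≡ x) (λ u → iter f u c ≟ₓ x) t reached
... | r , _ , first , earlier = r , first , λ q 1≤q q≤r closed →
  earlier (r ∸ q) (∸-monoʳ-< {r} {q} {0} 1≤q q≤r) (begin
    iter f (r ∸ q) c            ≡⟨ cong (iter f (r ∸ q)) (sym closed) ⟩
    iter f (r ∸ q) (iter f q c) ≡⟨ sym (iter-+ f (r ∸ q) q c) ⟩
    iter f (r ∸ q + q) c        ≡⟨ cong (λ z → iter f z c) (m∸n+n≡m q≤r) ⟩
    iter f r c                  ≡⟨ first ⟩
    x                           ∎)
  where open ≡-Reasoning

reached⇒InL : ∀ {n} (A : Array n) R C (c x : Cell n) (t : ℕ) → iter (move A R C) t c ≡ x → InL A R C c x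
reached⇒InL A R C = firstVisit (≡-dec _≟ᶠ_ _≟ᶠ_) (move A R C)

module Dynamics (m : ℕ) (A : Array (suc m)) (const : DiagonalConstant A)
                (C : Fin (suc m) → Sign) where
  open Torus m
  open DiagonalArray m A const

  S : Cell N → Cell N
  S = move A (λ _ → plus) C

  step-plus : ∀ δ j → filled δ ≡ true → C (shift j (gap δ)) ≡ plus →
              S (cellOn δ j) ≡ cellOn δ (shift j (gap δ))
  step-plus δ j fδ c+ = begin
    S (cellOn δ j)                         ≡⟨ cong (λ y → colMove A (C (proj₂ y)) y) (rowSucc-cellOn δ j fδ) ⟩
    colMove A (C j′) (cellOn (prev δ) j′)  ≡⟨ cong (λ σ → colMove A σ (cellOn (prev δ) j′)) c+ ⟩
    colSucc A (cellOn (prev δ) j′)         ≡⟨ colSucc-prev δ j′ fδ ⟩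
    cellOn δ j′                            ∎
    where
    open ≡-Reasoning
    j′ = shift j (gap δ)

  step-minus : ∀ δ j → filled δ ≡ true → C (shift j (gap δ)) ≡ minus →
               S (cellOn δ j) ≡ cellOn (prev² δ) (shift j (gap δ))
  step-minus δ j fδ c- = begin
    S (cellOn δ j)                         ≡⟨ cong (λ y → colMove A (C (proj₂ y)) y) (rowSucc-cellOn δ j fδ) ⟩
    colMove A (C j′) (cellOn (prev δ) j′)  ≡⟨ cong (λ σ → colMove A σ (cellOn (prev δ) j′)) c- ⟩
    colPred A (cellOn (prev δ) j′)         ≡⟨ colPred-cellOn (prev δ) j′ (prev-filled δ fδ) ⟩
    cellOn (prev² δ) j′                    ∎
    where
    open ≡-Reasoning
    j′ = shift j (gap δ)

  filled-cellOn : ∀ δ j → filled δ ≡ true → filled (diagOf (cellOn δ j)) ≡ true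
  filled-cellOn δ j fδ = trans (cong filled (diagOf-cellOn δ j)) (trans (filled-% δ) fδ)

  S-filled-cellOn : ∀ δ j → filled δ ≡ true → filled (diagOf (S (cellOn δ j))) ≡ true
  S-filled-cellOn δ j fδ with C (shift j (gap δ)) in cj
  ... | plus  = subst (λ c → filled (diagOf c) ≡ true) (sym (step-plus δ j fδ cj)) (filled-cellOn δ (shift j (gap δ)) fδ)
  ... | minus = subst (λ c → filled (diagOf c) ≡ true) (sym (step-minus δ j fδ cj))
                      (filled-cellOn (prev² δ) (shift j (gap δ)) (prev²-filled δ fδ))

  S-filled : ∀ x → filled (diagOf x) ≡ true → filled (diagOf (S x)) ≡ true
  S-filled x fx = subst (λ c → filled (diagOf (S c)) ≡ true) (cellOn-diagOf x)
                        (S-filled-cellOn (diagOf x) (proj₂ x) fx)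

  module Entries (E : List (Fin N)) (minus⇔E : ∀ j → (C j ≡ minus) ⇔ (j ∈ E)) where
    open import Data.List.Membership.DecPropositional (_≟ᶠ_ {N}) using (_∈?_)

    minus-on-E : ∀ j → j ∈ E → C j ≡ minus
    minus-on-E j = Equivalence.from (minus⇔E j)

    minus⇒E : ∀ j → C j ≡ minus → j ∈ E
    minus⇒E j = Equivalence.to (minus⇔E j)

    plus-off-E : ∀ j → ¬ (j ∈ E) → C j ≡ plus
    plus-off-E j j∉E with C j in cj
    ... | plus  = refl
    ... | minus = ⊥-elim (j∉E (minus⇒E j cj))

    _↝_ : Cell N → Cell N → Set
    x ↝ y = Σ ℕ λ t → iter S t x ≡ y

    ↝-trans : ∀ {x y z} → x ↝ y → y ↝ z → x ↝ z
    ↝-trans {x} (a , xa) (b , yb) = b + a , trans (iter-+ S b a x) (trans (cong (iter S b) xa) yb)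

    walk-along : ∀ δ c t → filled δ ≡ true → (∀ u → 1 ≤ u → u ≤ t → ¬ (shift c (u * gap δ) ∈ E)) →
                 iter S t (cellOn δ c) ≡ cellOn δ (shift c (t * gap δ))
    walk-along δ c zero    fδ _   = cong (cellOn δ) (sym (shift-0 c))
    walk-along δ c (suc t) fδ off = begin
      S (iter S t (cellOn δ c))       ≡⟨ cong S (walk-along δ c t fδ (λ u 1≤u u≤t → off u 1≤u (m≤n⇒m≤1+n u≤t))) ⟩
      S (cellOn δ c′)                 ≡⟨ step-plus δ c′ fδ (plus-off-E (shift c′ (gap δ)) next∉E) ⟩
      cellOn δ (shift c′ (gap δ))     ≡⟨ cong (cellOn δ) next ⟩
      cellOn δ (shift c (suc t * gap δ)) ∎
      where
      open ≡-Reasoning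
      c′ = shift c (t * gap δ)
      next : shift c′ (gap δ) ≡ shift c (suc t * gap δ)
      next = trans (shift-shift c (t * gap δ) (gap δ)) (cong (shift c) (+-comm (t * gap δ) (gap δ)))
      next∉E : ¬ (shift c′ (gap δ) ∈ E)
      next∉E = subst (λ z → ¬ (z ∈ E)) (sym next) (off (suc t) (s≤s z≤n) ≤-refl)

    -- Going back from column j in steps of gap δ, let c be the first column of E met;
    -- walking forward from (δ, c) then reaches (δ, j) without meeting E.
    lastEntry : ∀ δ j → filled δ ≡ true → (Σ ℕ λ x → shift j (x * (N ∸ gap δ)) ∈ E) →
                Σ (Fin N) λ c → c ∈ E × cellOn δ c ↝ cellOn δ j
    lastEntry δ j fδ (x₀ , hit)
      with leastWitness (λ x → shift j (x * (N ∸ gap δ)) ∈ E) (λ x → shift j (x * (N ∸ gap δ)) ∈? E) x₀ hit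
    ... | r , _ , c∈E , earlier = c , c∈E , r , trans (walk-along δ c r fδ off) (cong (cellOn δ) arrive)
      where
      W = N ∸ gap δ
      c = shift j (r * W)
      column : ∀ u → u ≤ r → shift c (u * gap δ) ≡ shift j ((r ∸ u) * W)
      column u u≤r = trans (shift-shift j (r * W) (u * gap δ))
                           (shift-back j r u (gap δ) (GapSpec.gap≤N (gapSpec δ fδ)) u≤r)
      off : ∀ u → 1 ≤ u → u ≤ r → ¬ (shift c (u * gap δ) ∈ E)
      off u 1≤u u≤r inE = earlier (r ∸ u) (∸-monoʳ-< {r} {u} {0} 1≤u u≤r) (subst (_∈ E) (column u u≤r) inE)
      arrive : shift c (r * gap δ) ≡ j
      arrive = trans (column r ≤-refl) (trans (cong (λ z → shift j (z * W)) (n∸n≡0 r)) (shift-0 j))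

    -- the last step into (prev² δ, c): column c has sign -1
    step-down : ∀ δ c → filled δ ≡ true → c ∈ E → S (cellOn δ (shift c (N ∸ gap δ))) ≡ cellOn (prev² δ) c
    step-down δ c fδ c∈E = trans (step-minus δ c′ fδ (minus-on-E (shift c′ (gap δ)) (subst (_∈ E) (sym forward) c∈E)))
                                 (cong (cellOn (prev² δ)) forward)
      where
      c′ = shift c (N ∸ gap δ)
      forward : shift c′ (gap δ) ≡ c
      forward = shift-around c (gap δ) (GapSpec.gap≤N (gapSpec δ fδ))

    -- Every cell (prev² δ, c) with c ∈ E is entered from some (δ, c₀) with c₀ ∈ E:
    -- walk to column c - gap δ, then step down.
    descend : ∀ δ c → filled δ ≡ true → c ∈ E → Σ (Fin N) λ c₀ → c₀ ∈ E × cellOn δ c₀ ↝ cellOn (prev² δ) c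
    descend δ c fδ c∈E = c₀ , c₀∈E , ↝-trans walk (1 , step-down δ c fδ c∈E)
      where
      entered = lastEntry δ (shift c (N ∸ gap δ)) fδ (m , subst (_∈ E) (sym (shift-N-steps c (N ∸ gap δ))) c∈E)
      c₀ = proj₁ entered
      c₀∈E = proj₁ (proj₂ entered)
      walk = proj₂ (proj₂ entered)

    origin : Cell N
    origin = fzero , fzero

    InL⇒↝ : ∀ x → InL A (λ _ → plus) C origin x → origin ↝ x
    InL⇒↝ x (t , reached , _) = t , reached

    ↝⇒InL : ∀ x → origin ↝ x → InL A (λ _ → plus) C origin x
    ↝⇒InL x (t , reached) = reached⇒InL A (λ _ → plus) C origin x t reached

    prev²-iter-filled : filled 0 ≡ true → ∀ t → filled (iter prev² t 0) ≡ true
    prev²-iter-filled D₀ zero    = D₀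
    prev²-iter-filled D₀ (suc t) = prev²-filled _ (prev²-iter-filled D₀ t)

    entries : filled 0 ≡ true → (∀ e → e ∈ E → origin ↝ (e , e)) →
              ∀ t c → c ∈ E → origin ↝ cellOn (iter prev² t 0) c
    entries D₀ diag zero c c∈E = subst (origin ↝_) (cong (_, c) (sym (shift-0 c))) (diag c c∈E)
    entries D₀ diag (suc t) c c∈E = ↝-trans (entries D₀ diag t c₀ c₀∈E) step
      where
      entered = descend (iter prev² t 0) c (prev²-iter-filled D₀ t) c∈E
      c₀ = proj₁ entered
      c₀∈E = proj₁ (proj₂ entered)
      step = proj₂ (proj₂ entered)

    back-meets-E : ∀ {s} → CoversClasses (gcd N (s + 1)) E → ∀ G → G ≡ 1 ⊎ G ≡ suc s → G ≤ N →
                   ∀ j → Σ ℕ λ x → shift j (x * (N ∸ G)) ∈ E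
    back-meets-E cover G G-values G≤N j =
      x , subst (_∈ E) (sym (toℕ-injective (trans (toℕ-shift j (x * (N ∸ G))) lands))) e∈E
      where
      classmate = find-∈ (cover (toℕ j + 1))
      e = proj₁ classmate
      e∈E = proj₁ (proj₂ classmate)
      steps = backward-steps m (toℕ j) (toℕ e) G (toℕ<n e) G≤N
                (gcd-divides-distance G G-values j e (proj₂ (proj₂ classmate)))
      x = proj₁ steps
      lands = proj₂ steps

    -- Sufficiency: with an odd number of filled diagonals, coverage of the classes
    -- and the diagonal cells (e, e), every filled cell is reached from the origin:
    -- its diagonal is some prev²ᵗ 0, and its column is reached from an entry column.
    module Sufficiency {s} (hw : HasWidth A s) (D₀ : filled 0 ≡ true) (odd : rank N % 2 ≡ 1)
                       (cover : CoversClasses (gcd N (s + 1)) E) (diag : ∀ e → e ∈ E → origin ↝ (e , e)) where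

      reach-cellOn : ∀ δ j → δ < N → filled δ ≡ true → origin ↝ cellOn δ j
      reach-cellOn δ j δ<N fδ =
        ↝-trans (subst (λ δ′ → origin ↝ cellOn δ′ c) t-steps (entries D₀ diag t c c∈E)) walk
        where
        twice = Cycle.reach-twice D₀ odd δ δ<N fδ
        t = proj₁ twice
        t-steps = proj₂ twice
        entered = lastEntry δ j fδ (back-meets-E cover (gap δ) (gap-width hw δ fδ) (GapSpec.gap≤N (gapSpec δ fδ)) j)
        c = proj₁ entered
        c∈E = proj₁ (proj₂ entered)
        walk = proj₂ (proj₂ entered)

      reach-all : ∀ x → Filled A x → origin ↝ x
      reach-all x fx = subst (origin ↝_) (cellOn-diagOf x)
        (reach-cellOn (diagOf x) (proj₂ x) (diagOf<N x) (trans (sym (filled-diagOf x)) fx))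

    -- Suppose E misses the class of r
    -- modulo d = gcd(N, s + 1), and let T be the set of cells of diagonal 0 whose
    -- column is in that class.  From a cell of T the move advances the column by
    -- gap 0 = s + 1, staying in the class, hence off E, hence on diagonal 0: T is
    -- closed under the move, and also under its inverse on filled diagonals.  So the
    -- orbit of the origin lies in T or avoids T; either way it misses a filled cell.
    module MissedClass {s} (hw : HasWidth A s) (sf : StandardForm A) (r : ℕ)
                       (missed : ∀ e → e ∈ E → ¬ ModEq (gcd N (s + 1)) (toℕ e + 1) r) where

      d : ℕ
      d = gcd N (s + 1)

      instance
        d≢0 : NonZero d
        d≢0 = gcd-nonZero (s + 1)

      InClass : Fin N → Set
      InClass j = (toℕ j + 1) % d ≡ r % d

      T : Cell N → Set
      T x = diagOf x ≡ 0 × InClass (proj₂ x)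

      D₀ : filled 0 ≡ true
      D₀ = proj₁ sf fzero

      gap-0≡ : gap 0 ≡ suc s
      gap-0≡ = gap-0 hw sf

      class-shift : ∀ c → (toℕ (shift c (suc s)) + 1) % d ≡ (toℕ c + 1) % d
      class-shift c = begin
        (toℕ (shift c (suc s)) + 1) % d   ≡⟨ cong (λ z → (z + 1) % d) (toℕ-shift c (suc s)) ⟩
        ((toℕ c + suc s) % N + 1) % d     ≡⟨ %N-mod-divisor d (gcd[m,n]∣m N (s + 1)) (toℕ c + suc s) 1 ⟩
        (toℕ c + suc s + 1) % d           ≡⟨ cong (_% d) (regroup (toℕ c) s) ⟩
        (toℕ c + 1 + (s + 1)) % d         ≡⟨ %-remove-+ʳ (toℕ c + 1) (gcd[m,n]∣n N (s + 1)) ⟩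
        (toℕ c + 1) % d                   ∎
        where
        open ≡-Reasoning
        regroup : ∀ a s → a + suc s + 1 ≡ a + 1 + (s + 1)
        regroup = solve-∀

      off-E : ∀ j → InClass j → ¬ (j ∈ E)
      off-E j inClass j∈E = missed j j∈E (%⇒modEq d (toℕ j + 1) r inClass)

      -- from a cell of T the column advances by s + 1, which is off E, so S stays on diagonal 0
      T-forward : ∀ x → T x → T (S x)
      T-forward x (onDiag0 , inClass) =
        subst (λ c → T (S c)) (cellOn-diagOf x) (subst (λ δ → T (S (cellOn δ j))) (sym onDiag0) moved)
        where
        j = proj₂ x
        j′ = shift j (gap 0)
        inClass′ : InClass j′
        inClass′ = trans (cong (λ g → (toℕ (shift j g) + 1) % d) gap-0≡) (trans (class-shift j) inClass)
        moved : T (S (cellOn 0 j))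
        moved = subst T (sym (step-plus 0 j D₀ (plus-off-E j′ (off-E j′ inClass′)))) (diagOf-cellOn 0 j′ , inClass′)

      -- a cell on a filled diagonal moving into T was in T: a step down would need a
      -- column of E in the class, and a step along a diagonal keeps the diagonal
      T-backward-cellOn : ∀ δ c → δ < N → filled δ ≡ true → T (S (cellOn δ c)) → T (cellOn δ c)
      T-backward-cellOn δ c δ<N fδ T-next with C (shift c (gap δ)) in cj
      ... | minus = ⊥-elim (off-E j′ (subst InClass (cong proj₂ (step-minus δ c fδ cj)) (proj₂ T-next))
                                  (minus⇒E j′ cj))
        where j′ = shift c (gap δ)
      ... | plus = trans (diagOf-cellOn δ c) δ%N≡0 , trans (sym (class-shift c)) (subst InClass column (proj₂ T-next))
        where
        next≡ = step-plus δ c fδ cj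
        δ%N≡0 : δ % N ≡ 0
        δ%N≡0 = trans (sym (diagOf-cellOn δ (shift c (gap δ)))) (trans (cong diagOf (sym next≡)) (proj₁ T-next))
        column : proj₂ (S (cellOn δ c)) ≡ shift c (suc s)
        column = trans (cong proj₂ next≡)
          (trans (cong (λ δ′ → shift c (gap δ′)) (trans (sym (m<n⇒m%n≡m δ<N)) δ%N≡0)) (cong (shift c) gap-0≡))

      T-backward : ∀ y → filled (diagOf y) ≡ true → T (S y) → T y
      T-backward y fy T-next = subst T (cellOn-diagOf y)
        (T-backward-cellOn (diagOf y) (proj₂ y) (diagOf<N y) fy (subst (λ c → T (S c)) (sym (cellOn-diagOf y)) T-next))

      diagOf-origin : diagOf origin ≡ 0
      diagOf-origin = n%n≡0 N

      stays-in-T : T origin → ∀ t → T (iter S t origin)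
      stays-in-T T-origin t = iter-invariant S T T-forward t T-origin

      stays-out-of-T : ¬ T origin → ∀ t → ¬ T (iter S t origin)
      stays-out-of-T ¬T-origin t = proj₂ (iter-invariant S (λ x → filled (diagOf x) ≡ true × ¬ T x)
        (λ x (fx , ¬Tx) → S-filled x fx , λ T-next → ¬Tx (T-backward x fx T-next))
        t (trans (cong filled diagOf-origin) D₀ , ¬T-origin))

      T-witness : T (cellOn 0 (shift fzero (r + m)))
      T-witness = diagOf-cellOn 0 j₀ , (begin
        (toℕ j₀ + 1) % d          ≡⟨ cong (λ z → (z + 1) % d) (toℕ-shift fzero (r + m)) ⟩
        ((r + m) % N + 1) % d     ≡⟨ %N-mod-divisor d (gcd[m,n]∣m N (s + 1)) (r + m) 1 ⟩
        (r + m + 1) % d           ≡⟨ cong (_% d) (trans (+-assoc r m 1) (cong (r +_) (+-comm m 1))) ⟩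
        (r + N) % d               ≡⟨ %-remove-+ʳ r (gcd[m,n]∣m N (s + 1)) ⟩
        r % d                     ∎)
        where
        open ≡-Reasoning
        j₀ = shift fzero (r + m)

      inside-misses : T origin → ∀ δ₁ → δ₁ < N → δ₁ ≢ 0 → ¬ (origin ↝ cellOn δ₁ fzero)
      inside-misses T-origin δ₁ δ₁<N δ₁≢0 (t , reached) = δ₁≢0 (begin
        δ₁                          ≡⟨ sym (m<n⇒m%n≡m δ₁<N) ⟩
        δ₁ % N                      ≡⟨ sym (diagOf-cellOn δ₁ fzero) ⟩
        diagOf (cellOn δ₁ fzero)    ≡⟨ proj₁ (subst T reached (stays-in-T T-origin t)) ⟩
        0                           ∎)
        where open ≡-Reasoning

      outside-misses : ¬ T origin → ¬ (origin ↝ cellOn 0 (shift fzero (r + m)))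
      outside-misses ¬T-origin (t , reached) = stays-out-of-T ¬T-origin t (subst T (sym reached) T-witness)

      not-all-reached : (∀ x → Filled A x → origin ↝ x) → ∀ δ₁ → δ₁ < N → δ₁ ≢ 0 → filled δ₁ ≡ true → ⊥
      not-all-reached reach-all δ₁ δ₁<N δ₁≢0 fδ₁ with (toℕ (fzero {m}) + 1) % d ≟ r % d
      ... | yes origin-in-class =
        inside-misses (diagOf-origin , origin-in-class) δ₁ δ₁<N δ₁≢0
                      (reach-all (cellOn δ₁ fzero) (trans (const fzero δ₁) fδ₁))
      ... | no origin-off-class =
        outside-misses (λ T-origin → origin-off-class (proj₂ T-origin))
                       (reach-all (cellOn 0 (shift fzero (r + m))) (trans (const (shift fzero (r + m)) 0) D₀))

    reach-all⇒covers : ∀ {s} → HasWidth A s → StandardForm A → (∀ x → Filled A x → origin ↝ x) →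
                       (Σ ℕ λ δ₁ → δ₁ < N × δ₁ ≢ 0 × filled δ₁ ≡ true) → CoversClasses (gcd N (s + 1)) E
    reach-all⇒covers {s} hw sf reach-all (δ₁ , δ₁<N , δ₁≢0 , fδ₁) r
      with any? (λ e → modEq? (gcd N (s + 1)) {{gcd-nonZero (s + 1)}} (toℕ e + 1) r) E
    ... | yes covered = covered
    ... | no uncovered = ⊥-elim (MissedClass.not-all-reached hw sf r
            (λ e e∈E same → uncovered (lose e∈E same)) reach-all δ₁ δ₁<N δ₁≢0 fδ₁)

nonzero-entry : ∀ {N} (L : List (Fin N)) → Unique L → 2 ≤ length L → Σ (Fin N) λ a → toℕ a ≢ 0 × a ∈ L
nonzero-entry (_ ∷ []) _ (s≤s ())
nonzero-entry (a ∷ b ∷ _) ((a≢b ∷ _) ∷ _) _ with toℕ a ≟ 0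
... | no  a≢0 = a , a≢0 , here refl
... | yes a≡0 = b , (λ b≡0 → a≢b (toℕ-injective (trans a≡0 (sym b≡0)))) , there (here refl)

module KDiagonal (m k : ℕ) (A : Array (suc m)) (kd : IsKDiagonal k A) where
  open Torus m

  Ds : List (Fin N)
  Ds = proj₁ (proj₂ kd)

  Ds-length : length Ds ≡ k
  Ds-length = proj₁ (proj₂ (proj₂ kd))

  Ds-unique : Unique Ds
  Ds-unique = proj₁ (proj₂ (proj₂ (proj₂ kd)))

  filled⇔listed : ∀ x → Filled A x ⇔ Any (λ δ → OnDiag δ x) Ds
  filled⇔listed = proj₂ (proj₂ (proj₂ (proj₂ kd)))

  listed-any-column : ∀ j j′ δ → Any (λ δ′ → OnDiag δ′ (cellOn δ j)) Ds → Any (λ δ′ → OnDiag δ′ (cellOn δ j′)) Ds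
  listed-any-column j j′ δ = Any.map (λ {δ′} on → shift-mod j′ δ (toℕ δ′) (shift-injective j δ (toℕ δ′) on))

  diagonal-constant : DiagonalConstant A
  diagonal-constant j δ = ⇔→≡ {z = true} (mk⇔ (transfer j fzero) (transfer fzero j))
    where
    transfer : ∀ j j′ → Filled A (cellOn δ j) → Filled A (cellOn δ j′)
    transfer j j′ f = Equivalence.from (filled⇔listed (cellOn δ j′))
                        (listed-any-column j j′ δ (Equivalence.to (filled⇔listed (cellOn δ j)) f))

  open DiagonalArray m A diagonal-constant

  filled-listed : ∀ y → y < N → (filled y ≡ true) ⇔ Any (λ δ → toℕ δ ≡ y) Ds
  filled-listed y y<N = mk⇔
    (λ f → Any.map (λ {δ} on → sym (trans (sym (m<n⇒m%n≡m y<N)) (trans (shift-injective fzero y (toℕ δ) on) (toℕ%N δ))))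
                   (Equivalence.to (filled⇔listed (cellOn y fzero)) f))
    (λ listed → Equivalence.from (filled⇔listed (cellOn y fzero)) (Any.map (λ {δ} δ≡y → cong (shift fzero) (sym δ≡y)) listed))

  rank-N : rank N ≡ k
  rank-N = trans (count-list N Ds Ds-unique filled filled-listed) Ds-length

  second-diagonal : 2 ≤ k → Σ ℕ λ δ₁ → δ₁ < N × δ₁ ≢ 0 × filled δ₁ ≡ true
  second-diagonal 2≤k with nonzero-entry Ds Ds-unique (subst (2 ≤_) (sym Ds-length) 2≤k)
  ... | a , a≢0 , a∈Ds = toℕ a , toℕ<n a , a≢0 ,
    Equivalence.from (filled-listed (toℕ a) (toℕ<n a)) (Any.map (λ a≡δ → cong toℕ (sym a≡δ)) a∈Ds)

lemma4p18 : (k n s : ℕ) (pos : 0 < n) (A : Array n) (E : List (Fin n)) (C : Fin n → Sign)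
    → k % 2 ≡ 1 → 3 ≤ k → k < n
    → IsKDiagonal k A → HasWidth A s → StandardForm A
    → (∀ (j : Fin n) → (C j ≡ minus) ⇔ (j ∈ E))
    → IsSolution pos A (λ _ → plus) C
      ⇔ (CoversClasses (gcd n (s + 1)) E × (∀ (e : Fin n) → e ∈ E → InL A (λ _ → plus) C (cell11 pos) (e , e)))
lemma4p18 k (suc m) s (s≤s z≤n) A E C k-odd 3≤k _ kd hw sf minus⇔E = mk⇔
  (λ solution → reach-all⇒covers hw sf (λ x fx → InL⇒↝ x (solution x fx)) (second-diagonal 2≤k)
              , λ e _ → solution (e , e) (diagonal-cells-filled D₀ e))
  (λ (cover , diag) x fx →
     ↝⇒InL x (Sufficiency.reach-all hw D₀ odd cover (λ e e∈E → InL⇒↝ (e , e) (diag e e∈E)) x fx))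
  where
  open KDiagonal m k A kd
  open Torus m
  open DiagonalArray m A diagonal-constant
  open Dynamics m A diagonal-constant C
  open Entries E minus⇔E
  D₀ : filled 0 ≡ true
  D₀ = proj₁ sf fzero
  odd : rank N % 2 ≡ 1
  odd = trans (cong (_% 2) rank-N) k-odd
  2≤k : 2 ≤ k
  2≤k = ≤-trans (n≤1+n 2) 3≤k
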